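{- Let $\mathcal A$ be a total combinatory algebra, ${\sf RT}(\mathcal A)$ its realizability topos, and $A=(\mathcal A,E)$ with $E(a)=\{a\}$ the object of realizers. Then the scheme $$(\neg\phi\to\exists x{:}A\,\psi)\to\exists x{:}A\,(\neg\phi\to\psi),$$ for formulas $\phi,\psi$ with $x$ not free in $\phi$, is valid in ${\sf RT}(\mathcal A)$.
   Context: A total combinatory algebra is a partial combinatory algebra in which application is everywhere defined. The object of realizers is the assembly whose underlying set is $\mathcal A$ and in which each element is realized exactly by itself. -}

module Defs where

open import Level using (Level; suc; _⊔_) renaming (zero to lzero)
open import Data.Product using (Σ; ∃; ∃-syntax; _×_; _,_; proj₁; proj₂)
open import Data.Empty using (⊥)
open import Relation.Binary.PropositionalEquality using (_≡_)

record TCA : Set₁ where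
  infixl 9 _·_
  field
    Carrier : Set
    _·_     : Carrier → Carrier → Carrier
    k s     : Carrier
    k-law   : ∀ a b → (k · a) · b ≡ a
    s-law   : ∀ a b c → ((s · a) · b) · c ≡ (a · c) · (b · c)

module Realizability (𝒜 : TCA) where
  open TCA 𝒜 public

  -- truth values: subsets of the algebra (non-standard truth values)
  P : Set₁
  P = Carrier → Set

  _∈_ : Carrier → P → Set
  a ∈ p = p a

  -- standard combinators and pairing  ⟨a,b⟩ = λf. f a b
  i : Carrier
  i = (s · k) · k

  pair : Carrier → Carrier → Carrier
  pair a b = (s · ((s · i) · (k · a))) · (k · b)

  ⊥ᵖ : P
  ⊥ᵖ _ = ⊥

  _∧ᵖ_ : P → P → P
  (p ∧ᵖ q) c = Σ Carrier λ a → Σ Carrier λ b → (c ≡ pair a b) × (a ∈ p) × (b ∈ q)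

  _⇒ᵖ_ : P → P → P
  (p ⇒ᵖ q) a = ∀ b → b ∈ p → (a · b) ∈ q

  ¬ᵖ_ : P → P
  ¬ᵖ p = p ⇒ᵖ ⊥ᵖ

  -- Objects of RT(𝒜): sets with a (realizably) symmetric and transitive
  -- P-valued equality.

  record Obj : Set₁ where
    field
      X    : Set
      Eq   : X → X → P
      symR : Σ Carrier λ r → ∀ x y a → a ∈ Eq x y → (r · a) ∈ Eq y x
      trnR : Σ Carrier λ r → ∀ x y z a → a ∈ (Eq x y ∧ᵖ Eq y z) → (r · a) ∈ Eq x z

    E : X → P
    E x = Eq x x

  record Pred (Γ : Obj) : Set₁ where
    open Obj Γ
    field
      pr     : X → P
      strict : Σ Carrier λ r → ∀ x a → a ∈ pr x → (r · a) ∈ E x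
      extens : Σ Carrier λ r → ∀ x y a → a ∈ (Eq x y ∧ᵖ pr x) → (r · a) ∈ pr y

  -- the object of realizers  A = (𝒜, E) with E(a) = {a}, i.e.
  -- [a = b] = {c | c = a and a = b}
  EqA : Carrier → Carrier → P
  EqA a b c = (c ≡ a) × (a ≡ b)

  -- predicates on the product object  Γ × A  (strict and extensional
  -- w.r.t. the product equality  [(x,a) = (y,b)] = [x = y] ∧ [a = b])
  record PredA (Γ : Obj) : Set₁ where
    open Obj Γ
    field
      pr     : X → Carrier → P
      strict : Σ Carrier λ r → ∀ x a c → c ∈ pr x a → (r · c) ∈ (E x ∧ᵖ EqA a a)
      extens : Σ Carrier λ r → ∀ x y a b c →
               c ∈ ((Eq x y ∧ᵖ EqA a b) ∧ᵖ pr x a) → (r · c) ∈ pr y b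

  ∃A : {Γ : Obj} → PredA Γ → Obj.X Γ → P
  ∃A ψ x c = Σ Carrier λ y → c ∈ (EqA y y ∧ᵖ PredA.pr ψ x y)

  -- interpretation of the scheme  (¬φ → ∃x:A ψ) → ∃x:A (¬φ → ψ)
  -- in context Γ  (x not free in φ)
  scheme : {Γ : Obj} → Pred Γ → PredA Γ → Obj.X Γ → P
  scheme {Γ} φ ψ γ =
    ((¬ᵖ Pred.pr φ γ) ⇒ᵖ ∃A ψ γ)
      ⇒ᵖ (λ c → Σ Carrier λ y → c ∈ (EqA y y ∧ᵖ ((¬ᵖ Pred.pr φ γ) ⇒ᵖ PredA.pr ψ γ y)))

  Valid : (Γ : Obj) → (Obj.X Γ → P) → Set
  Valid Γ θ = Σ Carrier λ r → ∀ γ e → e ∈ Obj.E Γ γ → (r · e) ∈ θ γ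

-- The point is that negated propositions are realized "all or nothing":
-- if anything realizes ¬p then everything does, in particular the identity
-- combinator i.  So given a realizer c of ¬φ → ∃x:A ψ we may feed it i
-- without knowing a realizer of ¬φ; when ¬φ holds, c·i realizes ∃x:A ψ,
-- i.e. it is a pair whose first component is the witness x and whose second
-- component realizes ψ(x).  The answer is therefore the pair
--   ⟨ fst (c·i) , k·(snd (c·i)) ⟩,
-- the constant function k·_ realizing ¬φ → ψ.  When ¬φ fails the second
-- component is vacuously correct, and the witness is still a realizer.
module Submission where

open import Defs
open import Data.Product using (Σ; _×_; _,_)
open import Data.Empty using (⊥-elim)
open import Relation.Binary.PropositionalEquality
  using (_≡_; refl; sym; trans; cong; cong₂; subst; module ≡-Reasoning)

module SchemeProof (𝒜 : TCA) where
  open Realizability 𝒜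
  open ≡-Reasoning

  i-law : ∀ a → i · a ≡ a
  i-law a = trans (s-law k k a) (k-law a (k · a))

  pair-law : ∀ a b f → pair a b · f ≡ (f · a) · b
  pair-law a b f = begin
    pair a b · f                                  ≡⟨ s-law _ _ f ⟩
    ((s · i) · (k · a)) · f · ((k · b) · f)       ≡⟨ cong₂ _·_ (s-law i (k · a) f) (k-law b f) ⟩
    (i · f) · ((k · a) · f) · b                   ≡⟨ cong (λ g → g · b) (cong₂ _·_ (i-law f) (k-law a f)) ⟩
    (f · a) · b                                   ∎

  -- Projections: fst = k and snd = k·i, applied as arguments to a pair.
  snd : Carrier
  snd = k · i

  fst-law : ∀ a b → pair a b · k ≡ a
  fst-law a b = trans (pair-law a b k) (k-law a b)

  snd-law : ∀ a b → pair a b · snd ≡ b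
  snd-law a b = begin
    pair a b · snd       ≡⟨ pair-law a b snd ⟩
    ((k · i) · a) · b    ≡⟨ cong (_· b) (k-law i a) ⟩
    i · b                ≡⟨ i-law b ⟩
    b                    ∎

  data Term : Set where
    var : Term
    con : Carrier → Term
    _$_ : Term → Term → Term

  infixl 9 _$_

  eval : Term → Carrier → Carrier
  eval var     v = v
  eval (con a) v = a
  eval (t $ u) v = eval t v · eval u v

  λ* : Term → Carrier
  λ* var     = i
  λ* (con a) = k · a
  λ* (t $ u) = (s · λ* t) · λ* u

  λ*-law : ∀ t v → λ* t · v ≡ eval t v
  λ*-law var     v = i-law v
  λ*-law (con a) v = k-law a v
  λ*-law (t $ u) v = trans (s-law (λ* t) (λ* u) v) (cong₂ _·_ (λ*-law t v) (λ*-law u v))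

  -- The pairing combinator as a term: it evaluates to  pair  by definition.
  pairTerm : Term → Term → Term
  pairTerm t u = con s $ (con s $ con i $ (con k $ t)) $ (con k $ u)

  ∧ᵖ-fst : ∀ {p q : P} {c} → c ∈ (p ∧ᵖ q) → (c · k) ∈ p
  ∧ᵖ-fst {p} (a , b , refl , a∈p , _) = subst p (sym (fst-law a b)) a∈p

  ∧ᵖ-snd : ∀ {p q : P} {c} → c ∈ (p ∧ᵖ q) → (c · snd) ∈ q
  ∧ᵖ-snd {q = q} (a , b , refl , _ , b∈q) = subst q (sym (snd-law a b)) b∈q

  ∃A-witness : ∀ {Γ} (ψ : PredA Γ) γ {d} → d ∈ ∃A ψ γ →
               (d · snd) ∈ PredA.pr ψ γ (d · k)
  ∃A-witness ψ γ (y , d∈) with ∧ᵖ-fst {EqA y y} d∈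
  ... | (fst≡y , _) = subst (λ x → (_ · snd) ∈ PredA.pr ψ γ x) (sym fst≡y) (∧ᵖ-snd d∈)

  -- Negations are realized uniformly: if any b realizes ¬p, then every a does
  -- (p has no realizers at all).
  ¬ᵖ-uniform : ∀ {p : P} {b} a → b ∈ (¬ᵖ p) → a ∈ (¬ᵖ p)
  ¬ᵖ-uniform a b∈¬p x x∈p = ⊥-elim (b∈¬p x x∈p)

  const-realizes : ∀ {p q : P} {w} → w ∈ q → (k · w) ∈ (p ⇒ᵖ q)
  const-realizes {q = q} {w} w∈q b _ = subst q (sym (k-law w b)) w∈q

  valid-uniform : ∀ (Γ : Obj) (θ : Obj.X Γ → P) r → (∀ γ → r ∈ θ γ) → Valid Γ θ
  valid-uniform Γ θ r r∈θ = k · r , λ γ e _ → subst (θ γ) (sym (k-law r e)) (r∈θ γ)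

  witness proofOf : Carrier → Carrier
  witness c = (c · i) · k
  proofOf c = (c · i) · snd

  choiceTerm : Term
  choiceTerm = pairTerm (var $ con i $ con k) (con k $ (var $ con i $ con snd))

  choice : Carrier
  choice = λ* choiceTerm

  choice-law : ∀ c → choice · c ≡ pair (witness c) (k · proofOf c)
  choice-law = λ*-law choiceTerm

  choice-realizes : ∀ {Γ} (φ : Pred Γ) (ψ : PredA Γ) γ → choice ∈ scheme φ ψ γ
  choice-realizes φ ψ γ c c∈ =
    witness c , witness c , k · proofOf c , choice-law c , (refl , refl) , proof-part
    where
    proof-part : (k · proofOf c) ∈ ((¬ᵖ Pred.pr φ γ) ⇒ᵖ PredA.pr ψ γ (witness c))
    proof-part b b∈¬φ =
      const-realizes {p = ¬ᵖ Pred.pr φ γ} {q = PredA.pr ψ γ (witness c)}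
        (∃A-witness ψ γ {c · i} (c∈ i (¬ᵖ-uniform {Pred.pr φ γ} {b} i b∈¬φ))) b b∈¬φ

lemma5p3 : (𝒜 : TCA) → let open Realizability 𝒜 in
    (Γ : Obj) (φ : Pred Γ) (ψ : PredA Γ) → Valid Γ (scheme φ ψ)
lemma5p3 𝒜 Γ φ ψ = valid-uniform Γ (scheme φ ψ) choice (choice-realizes φ ψ)
  where open Realizability 𝒜 using (scheme)
        open SchemeProof 𝒜
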